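{- Let $I$ be a partial order, let $X_I$, $G_I$ be as in the context, and let $<^*$ be any linear order of $X_I$ such that $n(x)>n(y)$ implies $x<^*y$. Then: (1) every element of $G_I$ equals a product $g_{x_1}g_{x_2}\cdots g_{x_m}$ ($m\ge 0$) with $x_1<^*x_2<^*\cdots<^*x_m$ in $X_I$, and this representation is unique; (3) if $X\subseteq X_I$ satisfies: whenever $\circledast_{x,y_1,y_2}$ holds and $x,y_1\in X$ then $y_2\in X$, then the same holds (existence and uniqueness of such representations with all $x_i\in X$) for the group $G_{X}$ generated by $\{g_y:y\in X\}$ subject to those defining relations of $G_I$ that mention only generators $g_y$ with $y\in X$; hence $G_X$ is (via the natural map) equal to the subgroup $\langle\{g_x:x\in X\}\rangle$ of $G_I$; (4) if $g=g_{y_1}\cdots g_{y_m}$ with $y_1,\dots,y_m\in X_I$ and $g=g_{x_1}\cdots g_{x_n}$ with $x_1<^*\cdots<^*x_n$, then $n\le m$.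
   Context: For a partial order $I$, $X_I$ is the set of pairs $x=(\bar t,\eta)$ where for some $n<\omega$, $\bar t=\langle t_0,\dots,t_n\rangle$ is a strictly decreasing sequence in $I$ ($t_n<_I t_{n-1}<_I\cdots<_I t_0$) and $\eta:\{0,\dots,n-1\}\to\{0,1\}$; write $\bar t^x=\bar t$, $\eta^x=\eta$, $n(x)=n$. For $m\le n(x)$ let $x\upharpoonleft m=(\langle t_0,\dots,t_m\rangle,\eta\restriction m)$. For $x,y_1,y_2\in X_I$, $\circledast_{x,y_1,y_2}$ means: $n(x)<n(y_1)=n(y_2)$, $y_1\upharpoonleft n(x)=y_2\upharpoonleft n(x)$, $\bar t^{y_1}=\bar t^{y_2}$, and for every $\ell<n(y_1)$: $\eta^{y_1}(\ell)\ne\eta^{y_2}(\ell)$ iff ($\ell=n(x)$ and $x=y_1\upharpoonleft n(x)$). $G_I$ is the group generated by $\{g_x:x\in X_I\}$ subject only to the relations: $g_x^{2}=e$ for all $x\in X_I$; $g_{y_1}g_{y_2}=g_{y_2}g_{y_1}$ whenever $n(y_1)=n(y_2)$; and $g_xg_{y_1}g_x^{ -1}=g_{y_2}$ whenever $\circledast_{x,y_1,y_2}$. -}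

module Defs where

open import Level using (Level; _⊔_)
open import Data.Nat using (ℕ; zero; suc; _<_)
open import Data.Bool using (Bool; true; false; not)
open import Data.Product using (_×_; _,_)
open import Data.List using (List; []; _∷_; _++_; length; take; map)
open import Data.List.Relation.Unary.Linked using (Linked)
open import Relation.Binary.Core using (Rel)
open import Relation.Binary.PropositionalEquality using (_≡_; _≢_)
open import Function.Bundles using (_⇔_)

-- Groups given by generators and relations, as words modulo the
-- congruence generated by the relations and free cancellation.
-- A letter (true , a) stands for g_a, and (false , a) for g_a⁻¹.

module Presentation {b r : Level} (B : Set b)
                    (R : List (Bool × B) → List (Bool × B) → Set r) where

  Word : Set b
  Word = List (Bool × B)

  infix 4 _≈_
  data _≈_ : Word → Word → Set (b ⊔ r) where
    ≈-refl  : ∀ {u} → u ≈ u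
    ≈-sym   : ∀ {u v} → u ≈ v → v ≈ u
    ≈-trans : ∀ {u v w} → u ≈ v → v ≈ w → u ≈ w
    ≈-rel   : ∀ u {v v'} w → R v v' → (u ++ v ++ w) ≈ (u ++ v' ++ w)
    ≈-free  : ∀ u s x w → (u ++ (s , x) ∷ (not s , x) ∷ w) ≈ (u ++ w)

word : ∀ {b} {B : Set b} → List B → List (Bool × B)
word = map (λ x → (true , x))

module Setup {a ℓ : Level} {A : Set a} (_⊏_ : Rel A ℓ) where

  -- x = (t̄ , η) with t̄ = ⟨t₀,…,t_n⟩ (as a list, t₀ first), t_{i+1} ⊏ t_i,
  -- and η = ⟨η(0),…,η(n-1)⟩.  Well-formedness proofs are irrelevant, so
  -- equality of elements of X_I is equality of the pair (t̄ , η).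
  record XI : Set (a ⊔ ℓ) where
    constructor mkX
    field
      ts   : List A
      η    : List Bool
      .len : length ts ≡ suc (length η)
      .dec : Linked (λ s t → t ⊏ s) ts
  open XI public

  n : XI → ℕ
  n x = length (η x)

  ⟪_⟫ : XI → List A × List Bool
  ⟪ x ⟫ = ts x , η x

  _↾_ : XI → ℕ → List A × List Bool
  x ↾ m = take (suc m) (ts x) , take m (η x)

  -- η(ℓ) (only used for ℓ < n(x), where it is in range)
  at : List Bool → ℕ → Bool
  at []       _       = false
  at (b ∷ bs) zero    = b
  at (b ∷ bs) (suc k) = at bs k

  ⊛ : XI → XI → XI → Set a
  ⊛ x y₁ y₂ =
    (n x < n y₁) × (n y₁ ≡ n y₂) × (y₁ ↾ n x ≡ y₂ ↾ n x) × (ts y₁ ≡ ts y₂) ×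
    (∀ k → k < n y₁ →
       (at (η y₁) k ≢ at (η y₂) k) ⇔ ((k ≡ n x) × (⟪ x ⟫ ≡ y₁ ↾ n x)))

  -- The defining relations, for generators indexed by B via e : B → X_I
  -- (e = id gives G_I; e = inclusion of X ⊆ X_I gives G_X).
  data Rels {b} {B : Set b} (e : B → XI) : List (Bool × B) → List (Bool × B) → Set (a ⊔ ℓ ⊔ b) where
    r-inv  : ∀ x → Rels e ((true , x) ∷ (true , x) ∷ []) []
    r-comm : ∀ y₁ y₂ → n (e y₁) ≡ n (e y₂) →
             Rels e ((true , y₁) ∷ (true , y₂) ∷ []) ((true , y₂) ∷ (true , y₁) ∷ [])
    r-conj : ∀ x y₁ y₂ → ⊛ (e x) (e y₁) (e y₂) →
             Rels e ((true , x) ∷ (true , y₁) ∷ (false , x) ∷ []) ((true , y₂) ∷ [])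

  module GI = Presentation XI (Rels (λ x → x))

  record SubX {p} (P : XI → Set p) : Set (a ⊔ ℓ ⊔ p) where
    constructor ⟨_,_⟩
    field
      elt  : XI
      .mem : P elt
  open SubX public

  module GX {p} (P : XI → Set p) = Presentation (SubX P) (Rels elt)

  incl : ∀ {p} {P : XI → Set p} → List (Bool × SubX P) → List (Bool × XI)
  incl = map (λ { (s , y) → s , elt y })

{-# OPTIONS --safe #-}
module Submission where

-- For n(x) < n(y), conjugation by g_x sends g_y to g_(σ x y), where σ x flips the bit η(n(x)) of
-- those y that extend x. Each σ x is an involution of X_I, and the defining relations of G_I become
-- identities between these involutions.
-- Existence: sort a word by insertion, cancelling g_y g_y and moving g_y to the right past g_x for
-- x <* y by g_y g_x = g_(σ y x) g_y; this never lengthens the word, which gives (4).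
-- Uniqueness: G_I acts on the subsets of X_I by g_y · S = σ y (S) Δ {y}, and a sorted product
-- g_(x₁) ⋯ g_(xₘ) sends ∅ to {x₁, …, xₘ}, because σ xᵢ fixes every later xⱼ, whose level is at
-- most n(xᵢ). For X closed under ⊛ the insertion stays inside X, and uniqueness in G_X is pulled
-- back from G_I.

open import Defs
open import Level using (Level)
open import Function using (_∘_; _on_; id)
open import Function.Bundles using (_⇔_; mk⇔; Equivalence)
open import Data.Sum using (inj₁; inj₂)
open import Data.Bool using (Bool; true; false; not; _∧_; _xor_)
import Data.Bool.Properties as Bool
open import Data.Nat using (ℕ; zero; suc; _<_; _≤_; z≤n; s≤s)
import Data.Nat.Properties as ℕ
open import Data.Product using (Σ; _×_; _,_; proj₁; proj₂; map₂)
import Data.Product.Properties as Product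
open import Data.List using (List; []; _∷_; _++_; length; take; map)
import Data.List.Properties as List
open import Data.List.Relation.Unary.All as All using (All; []; _∷_)
open import Data.List.Relation.Unary.AllPairs using (AllPairs; []; _∷_)
import Data.List.Relation.Unary.AllPairs.Properties as AllPairs
open import Data.List.Relation.Unary.Linked using (Linked; [-])
open import Data.List.Relation.Unary.Linked.Properties using (Linked⇒AllPairs; AllPairs⇒Linked)
open import Relation.Nullary using (Dec; yes; no; does; contradiction)
open import Relation.Nullary.Decidable using (map′; does-⇔; dec-true; dec-false; decidable-stable; _×-dec_)
open import Relation.Binary.Core using (Rel)
open import Relation.Binary.Definitions using (DecidableEquality; Trichotomous; Transitive; tri<; tri≈; tri>)
open import Relation.Binary.Structures using (IsStrictPartialOrder; IsStrictTotalOrder)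
open import Relation.Binary.PropositionalEquality
  using (_≡_; _≢_; _≗_; refl; sym; trans; cong; cong₂; cong-app; subst; subst₂; ≢-sym; module ≡-Reasoning)

take-take-≤ : ∀ {a} {X : Set a} {i k} (xs : List X) → i ≤ k → take i (take k xs) ≡ take i xs
take-take-≤ {i = i} {k} xs i≤k = trans (List.take-take i k xs) (cong (λ j → take j xs) (ℕ.m≤n⇒m⊓n≡m i≤k))

xor-cancelˡ : ∀ a {b c} → a xor b ≡ a xor c → b ≡ c
xor-cancelˡ false eq = eq
xor-cancelˡ true  eq = Bool.not-injective eq

xor-cancel-middle : ∀ a b c → (a xor b) xor (c xor b) ≡ a xor c
xor-cancel-middle a b c = begin
  (a xor b) xor (c xor b)   ≡⟨ cong ((a xor b) xor_) (Bool.xor-comm c b) ⟩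
  (a xor b) xor (b xor c)   ≡⟨ Bool.xor-assoc a b (b xor c) ⟩
  a xor (b xor (b xor c))   ≡⟨ cong (a xor_) (Bool.xor-assoc b b c) ⟨
  a xor ((b xor b) xor c)   ≡⟨ cong (λ d → a xor (d xor c)) (Bool.xor-same b) ⟩
  a xor c                   ∎
  where open ≡-Reasoning

module _ {p} {P : Set p} {a c : Bool} where

  ≢⇔⇒≡xor : (P? : Dec P) → (a ≢ c) ⇔ P → c ≡ a xor does P?
  ≢⇔⇒≡xor (yes p) a≢c⇔P = trans (Bool.¬-not (≢-sym (Equivalence.from a≢c⇔P p))) (Bool.xor-comm true a)
  ≢⇔⇒≡xor (no ¬p) a≢c⇔P =
    trans (sym (decidable-stable (a Bool.≟ c) (¬p ∘ Equivalence.to a≢c⇔P))) (sym (Bool.xor-identityʳ a))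

  ≡xor⇒≢⇔ : (P? : Dec P) → c ≡ a xor does P? → (a ≢ c) ⇔ P
  ≡xor⇒≢⇔ (yes p) c≡a⊕1 =
    mk⇔ (λ _ → p) (λ _ a≡c → Bool.not-¬ refl (trans a≡c (trans c≡a⊕1 (Bool.xor-comm a true))))
  ≡xor⇒≢⇔ (no ¬p) c≡a⊕0 =
    mk⇔ (λ a≢c → contradiction (sym (trans c≡a⊕0 (Bool.xor-identityʳ a))) a≢c) (λ p → contradiction p ¬p)

does-≟-involution : ∀ {a} {A : Set a} (_≟_ : DecidableEquality A) {f : A → A} →
                    (∀ x → f (f x) ≡ x) → ∀ x y → does (x ≟ f y) ≡ does (f x ≟ y)
does-≟-involution _≟_ {f} f-inv x y =
  does-⇔ (mk⇔ (λ x≡fy → trans (cong f x≡fy) (f-inv y)) (λ fx≡y → trans (sym (f-inv x)) (cong f fx≡y)))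
         (x ≟ f y) (f x ≟ y)

xorAt : ℕ → Bool → List Bool → List Bool
xorAt _       _ []       = []
xorAt zero    b (c ∷ cs) = (c xor b) ∷ cs
xorAt (suc k) b (c ∷ cs) = c ∷ xorAt k b cs

length-xorAt : ∀ k b cs → length (xorAt k b cs) ≡ length cs
length-xorAt _       _ []       = refl
length-xorAt zero    b (c ∷ cs) = refl
length-xorAt (suc k) b (c ∷ cs) = cong suc (length-xorAt k b cs)

xorAt-false : ∀ k cs → xorAt k false cs ≡ cs
xorAt-false _       []       = refl
xorAt-false zero    (c ∷ cs) = cong (_∷ cs) (Bool.xor-identityʳ c)
xorAt-false (suc k) (c ∷ cs) = cong (c ∷_) (xorAt-false k cs)

xorAt-xorAt : ∀ k a b cs → xorAt k a (xorAt k b cs) ≡ xorAt k (b xor a) cs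
xorAt-xorAt _       a b []       = refl
xorAt-xorAt zero    a b (c ∷ cs) = cong (_∷ cs) (Bool.xor-assoc c b a)
xorAt-xorAt (suc k) a b (c ∷ cs) = cong (c ∷_) (xorAt-xorAt k a b cs)

xorAt-comm : ∀ j k a b cs → xorAt j a (xorAt k b cs) ≡ xorAt k b (xorAt j a cs)
xorAt-comm _       _       a b []       = refl
xorAt-comm zero    zero    a b (c ∷ cs) =
  cong (_∷ cs) (trans (Bool.xor-assoc c b a) (trans (cong (c xor_) (Bool.xor-comm b a)) (sym (Bool.xor-assoc c a b))))
xorAt-comm zero    (suc k) a b (c ∷ cs) = refl
xorAt-comm (suc j) zero    a b (c ∷ cs) = refl
xorAt-comm (suc j) (suc k) a b (c ∷ cs) = cong (c ∷_) (xorAt-comm j k a b cs)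

xorAt-beyond : ∀ {k} b cs → length cs ≤ k → xorAt k b cs ≡ cs
xorAt-beyond             b []       _         = refl
xorAt-beyond {suc k}     b (c ∷ cs) (s≤s len≤k) = cong (c ∷_) (xorAt-beyond b cs len≤k)

take-xorAt-≤ : ∀ {j k} b cs → j ≤ k → take j (xorAt k b cs) ≡ take j cs
take-xorAt-≤ {zero}              b cs       _         = refl
take-xorAt-≤ {suc j}             b []       _         = refl
take-xorAt-≤ {suc j} {suc k}     b (c ∷ cs) (s≤s j≤k) = cong (c ∷_) (take-xorAt-≤ b cs j≤k)

take-xorAt-< : ∀ {j k} b cs → k < j → take j (xorAt k b cs) ≡ xorAt k b (take j cs)
take-xorAt-< {suc j}             b []       _         = refl
take-xorAt-< {suc j} {zero}      b (c ∷ cs) _         = refl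
take-xorAt-< {suc j} {suc k}     b (c ∷ cs) (s≤s k<j) = cong (c ∷_) (take-xorAt-< b cs k<j)

module SortedLists {d ℓ} {D : Set d} {_<_ : Rel D ℓ}
                   (compare : Trichotomous _≡_ _<_) (<-trans : Transitive _<_) where

  toggle : D → List D → List D
  toggle y []       = y ∷ []
  toggle y (z ∷ zs) with compare y z
  ... | tri< _ _ _ = y ∷ z ∷ zs
  ... | tri≈ _ _ _ = zs
  ... | tri> _ _ _ = z ∷ toggle y zs

  multiply : (D → D → D) → D → List D → List D
  multiply conj y []       = y ∷ []
  multiply conj y (x ∷ xs) with compare y x
  ... | tri< _ _ _ = y ∷ x ∷ xs
  ... | tri≈ _ _ _ = xs
  ... | tri> _ _ _ = toggle (conj y x) (multiply conj y xs)

  module _ {p} {P : D → Set p} where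

    toggle-All : ∀ {y} zs → P y → All P zs → All P (toggle y zs)
    toggle-All {y} []       py []         = py ∷ []
    toggle-All {y} (z ∷ zs) py (pz ∷ pzs) with compare y z
    ... | tri< _ _ _ = py ∷ pz ∷ pzs
    ... | tri≈ _ _ _ = pzs
    ... | tri> _ _ _ = pz ∷ toggle-All zs py pzs

    multiply-All : ∀ conj {y} xs → (∀ {x} → P x → P (conj y x)) → P y → All P xs → All P (multiply conj y xs)
    multiply-All conj {y} []       _       py []         = py ∷ []
    multiply-All conj {y} (x ∷ xs) P-conj py (px ∷ pxs) with compare y x
    ... | tri< _ _ _ = py ∷ px ∷ pxs
    ... | tri≈ _ _ _ = pxs
    ... | tri> _ _ _ = toggle-All (multiply conj y xs) (P-conj px) (multiply-All conj xs P-conj py pxs)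

  toggle-sorted : ∀ y {zs} → AllPairs _<_ zs → AllPairs _<_ (toggle y zs)
  toggle-sorted y {[]}     []             = [] ∷ []
  toggle-sorted y {z ∷ zs} (z<zs ∷ zs↑) with compare y z
  ... | tri< y<z _ _ = (y<z ∷ All.map (<-trans y<z) z<zs) ∷ z<zs ∷ zs↑
  ... | tri≈ _ _ _   = zs↑
  ... | tri> _ _ z<y = toggle-All zs z<y z<zs ∷ toggle-sorted y zs↑

  multiply-sorted : ∀ conj y {xs} → AllPairs _<_ xs → AllPairs _<_ (multiply conj y xs)
  multiply-sorted conj y {[]}     []             = [] ∷ []
  multiply-sorted conj y {x ∷ xs} (x<xs ∷ xs↑) with compare y x
  ... | tri< y<x _ _ = (y<x ∷ All.map (<-trans y<x) x<xs) ∷ x<xs ∷ xs↑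
  ... | tri≈ _ _ _   = xs↑
  ... | tri> _ _ _   = toggle-sorted (conj y x) (multiply-sorted conj y xs↑)

  length-toggle : ∀ y zs → length (toggle y zs) ≤ suc (length zs)
  length-toggle y []       = ℕ.≤-refl
  length-toggle y (z ∷ zs) with compare y z
  ... | tri< _ _ _ = ℕ.≤-refl
  ... | tri≈ _ _ _ = ℕ.m≤n⇒m≤1+n (ℕ.n≤1+n (length zs))
  ... | tri> _ _ _ = s≤s (length-toggle y zs)

  length-multiply : ∀ conj y xs → length (multiply conj y xs) ≤ suc (length xs)
  length-multiply conj y []       = ℕ.≤-refl
  length-multiply conj y (x ∷ xs) with compare y x
  ... | tri< _ _ _ = ℕ.≤-refl
  ... | tri≈ _ _ _ = ℕ.m≤n⇒m≤1+n (ℕ.n≤1+n (length xs))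
  ... | tri> _ _ _ = ℕ.≤-trans (length-toggle (conj y x) (multiply conj y xs)) (s≤s (length-multiply conj y xs))

module Parity {d ℓ} {D : Set d} {_<_ : Rel D ℓ} (<-isStrictTotalOrder : IsStrictTotalOrder _≡_ _<_) where

  open IsStrictTotalOrder <-isStrictTotalOrder using (_≟_; compare; irrefl) renaming (trans to <-trans)

  δ : D → D → Bool
  δ y z = does (z ≟ y)

  parity : List D → D → Bool
  parity []       z = false
  parity (x ∷ xs) z = δ x z xor parity xs z

  parity-below : ∀ {z} xs → All (z <_) xs → parity xs z ≡ false
  parity-below      []       []           = refl
  parity-below {z} (x ∷ xs) (z<x ∷ z<xs) =
    cong₂ _xor_ (dec-false (z ≟ x) (λ z≡x → irrefl z≡x z<x)) (parity-below xs z<xs)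

  parity-head : ∀ {x xs} → All (x <_) xs → parity (x ∷ xs) x ≡ true
  parity-head {x} {xs} x<xs = cong₂ _xor_ (dec-true (x ≟ x) refl) (parity-below xs x<xs)

  parity-injective : ∀ {xs ys} → AllPairs _<_ xs → AllPairs _<_ ys → parity xs ≗ parity ys → xs ≡ ys
  parity-injective []             []             _ = refl
  parity-injective []             (y<ys ∷ _)     h = contradiction (trans (h _) (parity-head y<ys)) λ ()
  parity-injective (x<xs ∷ _)     []             h = contradiction (trans (sym (h _)) (parity-head x<xs)) λ ()
  parity-injective {x ∷ xs} {y ∷ ys} (x<xs ∷ xs↑) (y<ys ∷ ys↑) h with compare x y
  ... | tri< x<y _ _ = contradiction
    (trans (sym (parity-head x<xs)) (trans (h x) (parity-below (y ∷ ys) (x<y ∷ All.map (<-trans x<y) y<ys)))) λ ()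
  ... | tri> _ _ y<x = contradiction
    (trans (sym (parity-head y<ys)) (trans (sym (h y)) (parity-below (x ∷ xs) (y<x ∷ All.map (<-trans y<x) x<xs)))) λ ()
  ... | tri≈ _ refl _ = cong (x ∷_) (parity-injective xs↑ ys↑ (λ z → xor-cancelˡ (δ x z) (h z)))

module PresentationProperties {b r} {B : Set b} {R : Rel (List (Bool × B)) r} where

  open Presentation B R

  ∷-cong : ∀ l {u v} → u ≈ v → l ∷ u ≈ l ∷ v
  ∷-cong l ≈-refl             = ≈-refl
  ∷-cong l (≈-sym u≈v)        = ≈-sym (∷-cong l u≈v)
  ∷-cong l (≈-trans u≈v v≈w)  = ≈-trans (∷-cong l u≈v) (∷-cong l v≈w)
  ∷-cong l (≈-rel u w r)      = ≈-rel (l ∷ u) w r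
  ∷-cong l (≈-free u s x w)   = ≈-free (l ∷ u) s x w

  -- Both letters (true , y) and (false , y) act by act y, which is sound since act y is an involution.
  module Interpretation {z v} {Z : Set z} {V : Set v}
                        (act : B → (Z → V) → (Z → V))
                        (act-cong : ∀ y {f g} → f ≗ g → act y f ≗ act y g)
                        (act-involutive : ∀ y f → act y (act y f) ≗ f) where

    ⟦_⟧ : Word → (Z → V) → (Z → V)
    ⟦ []          ⟧ = id
    ⟦ (_ , y) ∷ w ⟧ = act y ∘ ⟦ w ⟧

    ⟦++⟧ : ∀ u w f → ⟦ u ++ w ⟧ f ≡ ⟦ u ⟧ (⟦ w ⟧ f)
    ⟦++⟧ []            w f = refl
    ⟦++⟧ ((_ , y) ∷ u) w f = cong (act y) (⟦++⟧ u w f)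

    ⟦⟧-cong : ∀ u {f g} → f ≗ g → ⟦ u ⟧ f ≗ ⟦ u ⟧ g
    ⟦⟧-cong []            f≗g = f≗g
    ⟦⟧-cong ((_ , y) ∷ u) f≗g = act-cong y (⟦⟧-cong u f≗g)

    module _ (act-respects : ∀ {v v′} → R v v′ → ∀ f → ⟦ v ⟧ f ≗ ⟦ v′ ⟧ f) where

      ≈⇒⟦⟧≗ : ∀ {u v} → u ≈ v → ∀ f → ⟦ u ⟧ f ≗ ⟦ v ⟧ f
      ≈⇒⟦⟧≗ ≈-refl              f z = refl
      ≈⇒⟦⟧≗ (≈-sym u≈v)         f z = sym (≈⇒⟦⟧≗ u≈v f z)
      ≈⇒⟦⟧≗ (≈-trans u≈v v≈w)   f z = trans (≈⇒⟦⟧≗ u≈v f z) (≈⇒⟦⟧≗ v≈w f z)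
      ≈⇒⟦⟧≗ (≈-rel u {v} {v′} w r) f z = begin
        ⟦ u ++ v ++ w ⟧ f z         ≡⟨ cong-app (⟦++⟧³ v) z ⟩
        ⟦ u ⟧ (⟦ v ⟧ (⟦ w ⟧ f)) z    ≡⟨ ⟦⟧-cong u (act-respects r (⟦ w ⟧ f)) z ⟩
        ⟦ u ⟧ (⟦ v′ ⟧ (⟦ w ⟧ f)) z   ≡⟨ cong-app (⟦++⟧³ v′) z ⟨
        ⟦ u ++ v′ ++ w ⟧ f z        ∎
        where
        open ≡-Reasoning
        ⟦++⟧³ : ∀ t → ⟦ u ++ t ++ w ⟧ f ≡ ⟦ u ⟧ (⟦ t ⟧ (⟦ w ⟧ f))
        ⟦++⟧³ t = trans (⟦++⟧ u (t ++ w) f) (cong ⟦ u ⟧ (⟦++⟧ t w f))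
      ≈⇒⟦⟧≗ (≈-free u s x w)    f z = begin
        ⟦ u ++ (s , x) ∷ (not s , x) ∷ w ⟧ f z   ≡⟨ cong-app (⟦++⟧ u _ f) z ⟩
        ⟦ u ⟧ (act x (act x (⟦ w ⟧ f))) z         ≡⟨ ⟦⟧-cong u (act-involutive x (⟦ w ⟧ f)) z ⟩
        ⟦ u ⟧ (⟦ w ⟧ f) z                         ≡⟨ cong-app (⟦++⟧ u w f) z ⟨
        ⟦ u ++ w ⟧ f z                            ∎
        where open ≡-Reasoning

mapWord : ∀ {b c} {B : Set b} {C : Set c} → (B → C) → List (Bool × B) → List (Bool × C)
mapWord f = map (map₂ f)

module _ {b c r s} {B : Set b} {C : Set c} {R : Rel (List (Bool × B)) r} {S : Rel (List (Bool × C)) s}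
         (f : B → C) (f-rel : ∀ {v v′} → R v v′ → S (mapWord f v) (mapWord f v′)) where

  private
    module PB = Presentation B R
    module PC = Presentation C S

  ≈-mapWord : ∀ {u v} → u PB.≈ v → mapWord f u PC.≈ mapWord f v
  ≈-mapWord PB.≈-refl            = PC.≈-refl
  ≈-mapWord (PB.≈-sym u≈v)       = PC.≈-sym (≈-mapWord u≈v)
  ≈-mapWord (PB.≈-trans u≈v v≈w) = PC.≈-trans (≈-mapWord u≈v) (≈-mapWord v≈w)
  ≈-mapWord (PB.≈-rel u {v} {v′} w r) =
    subst₂ PC._≈_ (sym (mapWord-++³ v)) (sym (mapWord-++³ v′)) (PC.≈-rel (mapWord f u) (mapWord f w) (f-rel r))
    where
    mapWord-++³ : ∀ t → mapWord f (u ++ t ++ w) ≡ mapWord f u ++ mapWord f t ++ mapWord f w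
    mapWord-++³ t = trans (List.map-++ _ u (t ++ w)) (cong (mapWord f u ++_) (List.map-++ _ t w))
  ≈-mapWord (PB.≈-free u s x w) =
    subst₂ PC._≈_ (sym (List.map-++ _ u _)) (sym (List.map-++ _ u w)) (PC.≈-free (mapWord f u) s (f x) (mapWord f w))

module Pairs {a} {A : Set a} (_≟A_ : DecidableEquality A) where

  Pair : Set a
  Pair = List A × List Bool

  infix 4 _≟_
  infixl 5 _⇂_

  _≟_ : DecidableEquality Pair
  _≟_ = Product.≡-dec (List.≡-dec _≟A_) (List.≡-dec Bool._≟_)

  level : Pair → ℕ
  level = length ∘ proj₂

  _⇂_ : Pair → ℕ → Pair
  p ⇂ m = take (suc m) (proj₁ p) , take m (proj₂ p)

  xorAtₚ : ℕ → Bool → Pair → Pair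
  xorAtₚ k b p = proj₁ p , xorAt k b (proj₂ p)

  isPrefix : Pair → Pair → Bool
  isPrefix q p = does (q ≟ p ⇂ level q)

  -- The paper also requires level q < level p; this is automatic, as otherwise position level q lies outside η.
  σ : Pair → Pair → Pair
  σ q p = xorAtₚ (level q) (isPrefix q p) p

  level-σ : ∀ q p → level (σ q p) ≡ level p
  level-σ q p = length-xorAt (level q) (isPrefix q p) (proj₂ p)

  ⇂-⇂ : ∀ {j m} p → j ≤ m → (p ⇂ m) ⇂ j ≡ p ⇂ j
  ⇂-⇂ p j≤m = cong₂ _,_ (take-take-≤ (proj₁ p) (s≤s j≤m)) (take-take-≤ (proj₂ p) j≤m)

  xorAtₚ-⇂ : ∀ {j k} b p → j ≤ k → xorAtₚ k b p ⇂ j ≡ p ⇂ j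
  xorAtₚ-⇂ {j} b p j≤k = cong (take (suc j) (proj₁ p) ,_) (take-xorAt-≤ b (proj₂ p) j≤k)

  isPrefix-⇂ : ∀ q {p p′} → p ⇂ level q ≡ p′ ⇂ level q → isPrefix q p ≡ isPrefix q p′
  isPrefix-⇂ q = cong (does ∘ (q ≟_))

  isPrefix-σ : ∀ q q′ p → level q ≤ level q′ → isPrefix q (σ q′ p) ≡ isPrefix q p
  isPrefix-σ q q′ p q≤q′ = isPrefix-⇂ q (xorAtₚ-⇂ (isPrefix q′ p) p q≤q′)

  σ-⇂ : ∀ {m} q p → level q < m → σ q p ⇂ m ≡ σ q (p ⇂ m)
  σ-⇂ {m} q p q<m = cong (take (suc m) (proj₁ p) ,_) (begin
    take m (xorAt (level q) (isPrefix q p) (proj₂ p))          ≡⟨ take-xorAt-< (isPrefix q p) (proj₂ p) q<m ⟩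
    xorAt (level q) (isPrefix q p) (take m (proj₂ p))          ≡⟨ cong (λ c → xorAt (level q) c (take m (proj₂ p)))
                                                                   (isPrefix-⇂ q (sym (⇂-⇂ p (ℕ.<⇒≤ q<m)))) ⟩
    xorAt (level q) (isPrefix q (p ⇂ m)) (take m (proj₂ p))    ∎)
    where open ≡-Reasoning

  σ-xorAtₚ : ∀ {m} q b p → level q < m → σ q (xorAtₚ m b p) ≡ xorAtₚ m b (σ q p)
  σ-xorAtₚ {m} q b p q<m = cong (proj₁ p ,_) (begin
    xorAt (level q) (isPrefix q (xorAtₚ m b p)) (xorAt m b (proj₂ p))  ≡⟨ cong (λ c → xorAt (level q) c _)
                                                                          (isPrefix-⇂ q (xorAtₚ-⇂ b p (ℕ.<⇒≤ q<m))) ⟩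
    xorAt (level q) (isPrefix q p) (xorAt m b (proj₂ p))               ≡⟨ xorAt-comm (level q) m _ b (proj₂ p) ⟩
    xorAt m b (xorAt (level q) (isPrefix q p) (proj₂ p))               ∎)
    where open ≡-Reasoning

  σ-involutive : ∀ q p → σ q (σ q p) ≡ p
  σ-involutive q p = cong (proj₁ p ,_) (begin
    xorAt k (isPrefix q (σ q p)) (xorAt k c (proj₂ p))  ≡⟨ cong (λ c′ → xorAt k c′ (xorAt k c (proj₂ p)))
                                                              (isPrefix-σ q q p ℕ.≤-refl) ⟩
    xorAt k c (xorAt k c (proj₂ p))                 ≡⟨ xorAt-xorAt k c c (proj₂ p) ⟩
    xorAt k (c xor c) (proj₂ p)                     ≡⟨ cong (λ c′ → xorAt k c′ (proj₂ p)) (Bool.xor-same c) ⟩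
    xorAt k false (proj₂ p)                         ≡⟨ xorAt-false k (proj₂ p) ⟩
    proj₂ p                                         ∎)
    where
    open ≡-Reasoning
    k = level q
    c = isPrefix q p

  σ-fix : ∀ q p → level p ≤ level q → σ q p ≡ p
  σ-fix q p p≤q = cong (proj₁ p ,_) (xorAt-beyond (isPrefix q p) (proj₂ p) p≤q)

  σ-comm : ∀ q q′ p → level q ≡ level q′ → σ q (σ q′ p) ≡ σ q′ (σ q p)
  σ-comm q q′ p q≡q′ = cong (proj₁ p ,_) (begin
    xorAt (level q) (isPrefix q (σ q′ p)) (xorAt (level q′) (isPrefix q′ p) (proj₂ p))
      ≡⟨ cong (λ c → xorAt (level q) c _) (isPrefix-σ q q′ p (ℕ.≤-reflexive q≡q′)) ⟩
    xorAt (level q) (isPrefix q p) (xorAt (level q′) (isPrefix q′ p) (proj₂ p))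
      ≡⟨ xorAt-comm (level q) (level q′) _ _ (proj₂ p) ⟩
    xorAt (level q′) (isPrefix q′ p) (xorAt (level q) (isPrefix q p) (proj₂ p))
      ≡⟨ cong (λ c → xorAt (level q′) c _) (isPrefix-σ q′ q p (ℕ.≤-reflexive (sym q≡q′))) ⟨
    xorAt (level q′) (isPrefix q′ (σ q p)) (xorAt (level q) (isPrefix q p) (proj₂ p))
      ∎)
    where open ≡-Reasoning

  σ-conj : ∀ q r p → level q < level r → σ q (σ r (σ q p)) ≡ σ (σ q r) p
  σ-conj q r p q<r = begin
    σ q (xorAtₚ m (isPrefix r (σ q p)) (σ q p))  ≡⟨ cong (λ c → σ q (xorAtₚ m c (σ q p))) isPrefix-conj ⟩
    σ q (xorAtₚ m c (σ q p))                 ≡⟨ σ-xorAtₚ q c (σ q p) q<r ⟩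
    xorAtₚ m c (σ q (σ q p))                 ≡⟨ cong (xorAtₚ m c) (σ-involutive q p) ⟩
    xorAtₚ m c p                             ≡⟨ cong (λ k → xorAtₚ k c p) (level-σ q r) ⟨
    σ (σ q r) p                              ∎
    where
    open ≡-Reasoning
    m = level r
    c = isPrefix (σ q r) p
    isPrefix-conj : isPrefix r (σ q p) ≡ c
    isPrefix-conj = begin
      does (r ≟ σ q p ⇂ m)      ≡⟨ cong (does ∘ (r ≟_)) (σ-⇂ q p q<r) ⟩
      does (r ≟ σ q (p ⇂ m))    ≡⟨ does-≟-involution _≟_ {σ q} (σ-involutive q) r (p ⇂ m) ⟩
      does (σ q r ≟ p ⇂ m)      ≡⟨ cong (λ k → does (σ q r ≟ p ⇂ k)) (level-σ q r) ⟨
      c                         ∎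

module Main {a ℓ ℓ′} {A : Set a} (_<I_ : Rel A ℓ)
            (_<*_ : Rel (Setup.XI _<I_) ℓ′) (<*-isStrictTotalOrder : IsStrictTotalOrder _≡_ _<*_)
            (<*-level : ∀ x y → Setup.n _<I_ y < Setup.n _<I_ x → x <* y) where

  open Setup _<I_
  open IsStrictTotalOrder <*-isStrictTotalOrder using (_≟_; compare) renaming (trans to <*-trans; asym to <*-asym)
  open Parity <*-isStrictTotalOrder using (δ; parity; parity-injective)
  open PresentationProperties using (∷-cong)

  <*⇒level-≥ : ∀ {x y} → x <* y → n y ≤ n x
  <*⇒level-≥ {x} {y} x<y = ℕ.≮⇒≥ (<*-asym x<y ∘ <*-level y x)

  sorted : ∀ {xs} → Linked _<*_ xs → AllPairs _<*_ xs
  sorted = Linked⇒AllPairs <*-trans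

  singleton : A → XI
  singleton t = mkX (t ∷ []) [] refl [-]

  -- Elements t of I are the one-point sequences ⟨t⟩ of X_I, so the total order <* decides equality on I.
  _≟A_ : DecidableEquality A
  s ≟A t = map′ (List.∷-injectiveˡ ∘ cong ts) (cong singleton) (singleton s ≟ singleton t)

  module Pr = Pairs _≟A_

  ⟪⟫-injective : ∀ {x y} → ⟪ x ⟫ ≡ ⟪ y ⟫ → x ≡ y
  ⟪⟫-injective {mkX _ _ _ _} {mkX _ _ _ _} refl = refl

  σ : XI → XI → XI
  σ x (mkX t e t≡1+e t↓) =
    mkX t (proj₂ (Pr.σ ⟪ x ⟫ (t , e))) (trans t≡1+e (cong suc (sym (Pr.level-σ ⟪ x ⟫ (t , e))))) t↓

  level-σ : ∀ x y → n (σ x y) ≡ n y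
  level-σ x y = Pr.level-σ ⟪ x ⟫ ⟪ y ⟫

  σ-involutive : ∀ x y → σ x (σ x y) ≡ y
  σ-involutive x y = ⟪⟫-injective (Pr.σ-involutive ⟪ x ⟫ ⟪ y ⟫)

  σ-fix : ∀ x y → n y ≤ n x → σ x y ≡ y
  σ-fix x y y≤x = ⟪⟫-injective (Pr.σ-fix ⟪ x ⟫ ⟪ y ⟫ y≤x)

  σ-comm : ∀ x x′ y → n x ≡ n x′ → σ x (σ x′ y) ≡ σ x′ (σ x y)
  σ-comm x x′ y x≡x′ = ⟪⟫-injective (Pr.σ-comm ⟪ x ⟫ ⟪ x′ ⟫ ⟪ y ⟫ x≡x′)

  σ-conj : ∀ x y z → n x < n y → σ x (σ y (σ x z)) ≡ σ (σ x y) z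
  σ-conj x y z x<y = ⟪⟫-injective (Pr.σ-conj ⟪ x ⟫ ⟪ y ⟫ ⟪ z ⟫ x<y)

  at-xorAt : ∀ {j} k b cs → j < length cs → at (xorAt k b cs) j ≡ at cs j xor (does (j ℕ.≟ k) ∧ b)
  at-xorAt {zero}  zero    b (c ∷ cs) _         = refl
  at-xorAt {zero}  (suc k) b (c ∷ cs) _         = sym (Bool.xor-identityʳ c)
  at-xorAt {suc j} zero    b (c ∷ cs) _         = sym (Bool.xor-identityʳ (at cs j))
  at-xorAt {suc j} (suc k) b (c ∷ cs) (s≤s j<k) = at-xorAt k b cs j<k

  at-injective : ∀ {cs ds} → length cs ≡ length ds → (∀ j → j < length cs → at cs j ≡ at ds j) → cs ≡ ds
  at-injective {[]}     {[]}     _     _   = refl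
  at-injective {c ∷ cs} {d ∷ ds} cs≡ds at≡ =
    cong₂ _∷_ (at≡ zero (s≤s z≤n)) (at-injective (ℕ.suc-injective cs≡ds) (λ j j< → at≡ (suc j) (s≤s j<)))

  ⊛⇒σ : ∀ x y₁ y₂ → ⊛ x y₁ y₂ → y₂ ≡ σ x y₁
  ⊛⇒σ x y₁ y₂ (_ , n≡ , _ , ts≡ , differs) = ⟪⟫-injective (cong₂ _,_ (sym ts≡) (at-injective length≡ at≡))
    where
    length≡ : n y₂ ≡ length (xorAt (n x) (Pr.isPrefix ⟪ x ⟫ ⟪ y₁ ⟫) (η y₁))
    length≡ = trans (sym n≡) (sym (length-xorAt _ _ (η y₁)))
    at≡ : ∀ j → j < n y₂ → at (η y₂) j ≡ at (xorAt (n x) (Pr.isPrefix ⟪ x ⟫ ⟪ y₁ ⟫) (η y₁)) j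
    at≡ j j<y₂ = trans (≢⇔⇒≡xor ((j ℕ.≟ n x) ×-dec (⟪ x ⟫ Pr.≟ y₁ ↾ n x)) (differs j j<y₁))
                       (sym (at-xorAt (n x) _ (η y₁) j<y₁))
      where j<y₁ = subst (j <_) (sym n≡) j<y₂

  σ⇒⊛ : ∀ x y → n x < n y → ⊛ x y (σ x y)
  σ⇒⊛ x y x<y =
    x<y , sym (level-σ x y) , sym (Pr.xorAtₚ-⇂ _ ⟪ y ⟫ ℕ.≤-refl) , refl ,
    λ j j<y → ≡xor⇒≢⇔ ((j ℕ.≟ n x) ×-dec (⟪ x ⟫ Pr.≟ y ↾ n x)) (at-xorAt (n x) _ (η y) j<y)

  δ-σ : ∀ x y z → δ y (σ x z) ≡ δ (σ x y) z
  δ-σ x y z = sym (does-≟-involution _≟_ {σ x} (σ-involutive x) z y)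

  act : XI → (XI → Bool) → (XI → Bool)
  act y c z = c (σ y z) xor δ y z

  act-cong : ∀ y {c d} → c ≗ d → act y c ≗ act y d
  act-cong y c≗d z = cong (_xor δ y z) (c≗d (σ y z))

  act-act : ∀ y₁ y₂ c z → act y₁ (act y₂ c) z ≡ c (σ y₂ (σ y₁ z)) xor (δ (σ y₁ y₂) z xor δ y₁ z)
  act-act y₁ y₂ c z =
    trans (Bool.xor-assoc (c (σ y₂ (σ y₁ z))) (δ y₂ (σ y₁ z)) (δ y₁ z))
          (cong (λ d → c (σ y₂ (σ y₁ z)) xor (d xor δ y₁ z)) (δ-σ y₁ y₂ z))

  act-act-≤ : ∀ y₁ y₂ c z → n y₂ ≤ n y₁ → act y₁ (act y₂ c) z ≡ c (σ y₂ (σ y₁ z)) xor (δ y₂ z xor δ y₁ z)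
  act-act-≤ y₁ y₂ c z y₂≤y₁ =
    trans (act-act y₁ y₂ c z) (cong (λ y → c (σ y₂ (σ y₁ z)) xor (δ y z xor δ y₁ z)) (σ-fix y₁ y₂ y₂≤y₁))

  act-involutive : ∀ y c → act y (act y c) ≗ c
  act-involutive y c z = begin
    act y (act y c) z                       ≡⟨ act-act-≤ y y c z ℕ.≤-refl ⟩
    c (σ y (σ y z)) xor (δ y z xor δ y z)   ≡⟨ cong₂ _xor_ (cong c (σ-involutive y z)) (Bool.xor-same (δ y z)) ⟩
    c z xor false                           ≡⟨ Bool.xor-identityʳ (c z) ⟩
    c z                                     ∎
    where open ≡-Reasoning

  act-comm : ∀ y₁ y₂ c → n y₁ ≡ n y₂ → act y₁ (act y₂ c) ≗ act y₂ (act y₁ c)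
  act-comm y₁ y₂ c y₁≡y₂ z = begin
    act y₁ (act y₂ c) z                          ≡⟨ act-act-≤ y₁ y₂ c z (ℕ.≤-reflexive (sym y₁≡y₂)) ⟩
    c (σ y₂ (σ y₁ z)) xor (δ y₂ z xor δ y₁ z)    ≡⟨ cong₂ _xor_ (cong c (σ-comm y₂ y₁ z (sym y₁≡y₂)))
                                                                (Bool.xor-comm (δ y₂ z) (δ y₁ z)) ⟩
    c (σ y₁ (σ y₂ z)) xor (δ y₁ z xor δ y₂ z)    ≡⟨ act-act-≤ y₂ y₁ c z (ℕ.≤-reflexive y₁≡y₂) ⟨
    act y₂ (act y₁ c) z                          ∎
    where open ≡-Reasoning

  act-conj : ∀ x y c → n x < n y → act x (act y (act x c)) ≗ act (σ x y) c
  act-conj x y c x<y z = begin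
    act x (act y (act x c)) z
      ≡⟨ act-act x y (act x c) z ⟩
    (c (σ x (σ y (σ x z))) xor δ x (σ y (σ x z))) xor (δ (σ x y) z xor δ x z)
      ≡⟨ cong₂ (λ w d → (c w xor d) xor (δ (σ x y) z xor δ x z)) (σ-conj x y z x<y) δ-x ⟩
    (c (σ (σ x y) z) xor δ x z) xor (δ (σ x y) z xor δ x z)
      ≡⟨ xor-cancel-middle (c (σ (σ x y) z)) (δ x z) (δ (σ x y) z) ⟩
    act (σ x y) c z
      ∎
    where
    open ≡-Reasoning
    δ-x : δ x (σ y (σ x z)) ≡ δ x z
    δ-x = begin
      δ x (σ y (σ x z))    ≡⟨ δ-σ y x (σ x z) ⟩
      δ (σ y x) (σ x z)    ≡⟨ cong (λ w → δ w (σ x z)) (σ-fix y x (ℕ.<⇒≤ x<y)) ⟩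
      δ x (σ x z)          ≡⟨ δ-σ x x z ⟩
      δ (σ x x) z          ≡⟨ cong (λ w → δ w z) (σ-fix x x ℕ.≤-refl) ⟩
      δ x z                ∎

  open PresentationProperties.Interpretation {R = Rels id} act act-cong act-involutive

  act-respects : ∀ {v v′} → Rels id v v′ → ∀ c → ⟦ v ⟧ c ≗ ⟦ v′ ⟧ c
  act-respects (r-inv x)             c = act-involutive x c
  act-respects (r-comm y₁ y₂ y₁≡y₂)  c = act-comm y₁ y₂ c y₁≡y₂
  act-respects (r-conj x y₁ y₂ ⊛xy)  c z =
    trans (act-conj x y₁ c (proj₁ ⊛xy) z) (cong (λ y → act y c z) (sym (⊛⇒σ x y₁ y₂ ⊛xy)))

  parity-σ : ∀ x {xs} → All (λ y → n y ≤ n x) xs → ∀ z → parity xs (σ x z) ≡ parity xs z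
  parity-σ x []                  z = refl
  parity-σ x {y ∷ _} (y≤x ∷ ys≤x) z =
    cong₂ _xor_ (trans (δ-σ x y z) (cong (λ w → δ w z) (σ-fix x y y≤x))) (parity-σ x ys≤x z)

  ⟦word⟧ : ∀ {xs} → AllPairs _<*_ xs → ⟦ word xs ⟧ (λ _ → false) ≗ parity xs
  ⟦word⟧ []                      z = refl
  ⟦word⟧ {x ∷ xs} (x<xs ∷ xs↑) z = begin
    ⟦ word xs ⟧ (λ _ → false) (σ x z) xor δ x z  ≡⟨ cong (_xor δ x z) (⟦word⟧ xs↑ (σ x z)) ⟩
    parity xs (σ x z) xor δ x z                  ≡⟨ cong (_xor δ x z) (parity-σ x (All.map <*⇒level-≥ x<xs) z) ⟩
    parity xs z xor δ x z                        ≡⟨ Bool.xor-comm (parity xs z) (δ x z) ⟩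
    parity (x ∷ xs) z                            ∎
    where open ≡-Reasoning

  normalForm-unique : ∀ {xs ys} → AllPairs _<*_ xs → AllPairs _<*_ ys → GI._≈_ (word xs) (word ys) → xs ≡ ys
  normalForm-unique xs↑ ys↑ xs≈ys = parity-injective xs↑ ys↑ λ z →
    trans (sym (⟦word⟧ xs↑ z)) (trans (≈⇒⟦⟧≗ act-respects xs≈ys (λ _ → false) z) (⟦word⟧ ys↑ z))

  module NormalForm {b} {B : Set b} (e : B → XI) (e-injective : ∀ {u v} → e u ≡ e v → u ≡ v)
                    (σB : B → B → B) (e-σB : ∀ y x → e (σB y x) ≡ σ (e y) (e x)) where

    open Presentation B (Rels e)

    _<B_ : Rel B ℓ′
    _<B_ = _<*_ on e

    compareB : Trichotomous _≡_ _<B_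
    compareB u v with compare (e u) (e v)
    ... | tri< u<v u≢v u≯v = tri< u<v (u≢v ∘ cong e) u≯v
    ... | tri≈ u≮v u≡v u≯v = tri≈ u≮v (e-injective u≡v) u≯v
    ... | tri> u≮v u≢v u>v = tri> u≮v (u≢v ∘ cong e) u>v

    open SortedLists compareB <*-trans

    level-σB : ∀ y x → n (e (σB y x)) ≡ n (e x)
    level-σB y x = trans (cong n (e-σB y x)) (level-σ (e y) (e x))

    σB-fix : ∀ y x → n (e x) ≤ n (e y) → σB y x ≡ x
    σB-fix y x x≤y = e-injective (trans (e-σB y x) (σ-fix (e y) (e x) x≤y))

    letter-≈ : ∀ s y u → (s , y) ∷ u ≈ (true , y) ∷ u
    letter-≈ true  y u = ≈-refl
    letter-≈ false y u =
      ≈-trans (≈-sym (≈-rel ((false , y) ∷ []) u (r-inv y))) (≈-free [] false y ((true , y) ∷ u))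

    swap-≈ : ∀ {y x} w → n (e y) ≤ n (e x) → (true , y) ∷ (true , x) ∷ w ≈ (true , σB y x) ∷ (true , y) ∷ w
    swap-≈ {y} {x} w y≤x with ℕ.m≤n⇒m<n∨m≡n y≤x
    ... | inj₁ y<x = ≈-trans (≈-sym (≈-free ((true , y) ∷ (true , x) ∷ []) false y w))
                             (≈-rel [] ((true , y) ∷ w) (r-conj y x (σB y x) ⊛yx))
      where ⊛yx = subst (⊛ (e y) (e x)) (sym (e-σB y x)) (σ⇒⊛ (e y) (e x) y<x)
    ... | inj₂ y≡x = subst (λ t → _ ≈ (true , t) ∷ (true , y) ∷ w) (sym (σB-fix y x (ℕ.≤-reflexive (sym y≡x))))
                           (≈-rel [] w (r-comm y x y≡x))

    toggle-≈ : ∀ {y} zs → All (λ z → n (e z) ≤ n (e y)) zs → (true , y) ∷ word zs ≈ word (toggle y zs)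
    toggle-≈ {y} []       _              = ≈-refl
    toggle-≈ {y} (z ∷ zs) (z≤y ∷ zs≤y) with compareB y z
    ... | tri< _ _ _   = ≈-refl
    ... | tri≈ _ refl _ = ≈-rel [] (word zs) (r-inv y)
    ... | tri> _ _ z<y = ≈-trans (≈-rel [] (word zs) (r-comm y z (ℕ.≤-antisym (<*⇒level-≥ z<y) z≤y)))
                                 (∷-cong (true , z) (toggle-≈ zs zs≤y))

    multiply-≈ : ∀ y {xs} → AllPairs _<B_ xs → (true , y) ∷ word xs ≈ word (multiply σB y xs)
    multiply-≈ y {[]}     []             = ≈-refl
    multiply-≈ y {x ∷ xs} (x<xs ∷ xs↑) with compareB y x
    ... | tri< _ _ _    = ≈-refl
    ... | tri≈ _ refl _ = ≈-rel [] (word xs) (r-inv y)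
    ... | tri> _ _ x<y  = ≈-trans (swap-≈ (word xs) (<*⇒level-≥ x<y))
                         (≈-trans (∷-cong (true , σB y x) (multiply-≈ y xs↑))
                                  (toggle-≈ (multiply σB y xs) below))
      where
      below : All (λ z → n (e z) ≤ n (e (σB y x))) (multiply σB y xs)
      below = subst (λ k → All (λ z → n (e z) ≤ k) (multiply σB y xs)) (sym (level-σB y x))
                (multiply-All σB xs (λ {z} → ℕ.≤-trans (ℕ.≤-reflexive (level-σB y z)))
                              (<*⇒level-≥ x<y) (All.map <*⇒level-≥ x<xs))

    normalise : Word → List B
    normalise []            = []
    normalise ((_ , y) ∷ w) = multiply σB y (normalise w)

    normalise-sorted : ∀ w → AllPairs _<B_ (normalise w)
    normalise-sorted []            = []
    normalise-sorted ((_ , y) ∷ w) = multiply-sorted σB y (normalise-sorted w)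

    normalise-≈ : ∀ w → w ≈ word (normalise w)
    normalise-≈ []            = ≈-refl
    normalise-≈ ((s , y) ∷ w) =
      ≈-trans (∷-cong (s , y) (normalise-≈ w))
      (≈-trans (letter-≈ s y (word (normalise w))) (multiply-≈ y (normalise-sorted w)))

    length-normalise : ∀ w → length (normalise w) ≤ length w
    length-normalise []            = z≤n
    length-normalise ((_ , y) ∷ w) = ℕ.≤-trans (length-multiply σB y (normalise w)) (s≤s (length-normalise w))

  open NormalForm id id σ (λ _ _ → refl)

  normalForm-exists : ∀ w → Σ (List XI) λ xs → Linked _<*_ xs × GI._≈_ w (word xs)
  normalForm-exists w = normalise w , AllPairs⇒Linked (normalise-sorted w) , normalise-≈ w

  normalForm-shortest : ∀ ys xs → Linked _<*_ xs → GI._≈_ (word ys) (word xs) → length xs ≤ length ys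
  normalForm-shortest ys xs xs↑ ys≈xs = begin
    length xs                      ≡⟨ cong length normalise≡xs ⟨
    length (normalise (word ys))   ≤⟨ length-normalise (word ys) ⟩
    length (word ys)               ≡⟨ List.length-map _ ys ⟩
    length ys                      ∎
    where
    open ℕ.≤-Reasoning
    normalise≡xs = normalForm-unique (normalise-sorted (word ys)) (sorted xs↑)
                                     (GI.≈-trans (GI.≈-sym (normalise-≈ (word ys))) ys≈xs)

  module Subgroup {p} (P : XI → Set p) (P-closed : ∀ x y₁ y₂ → ⊛ x y₁ y₂ → P x → P y₁ → P y₂) where

    σ-closed : ∀ {y x} → P y → P x → P (σ y x)
    σ-closed {y} {x} py px with n y ℕ.<? n x
    ... | yes y<x = P-closed y x (σ y x) (σ⇒⊛ y x y<x) py px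
    ... | no  y≮x = subst P (sym (σ-fix y x (ℕ.≮⇒≥ y≮x))) px

    σX : SubX P → SubX P → SubX P
    σX ⟨ y , py ⟩ ⟨ x , px ⟩ = ⟨ σ y x , σ-closed py px ⟩

    elt-injective : ∀ {u v : SubX P} → elt u ≡ elt v → u ≡ v
    elt-injective {⟨ _ , _ ⟩} {⟨ _ , _ ⟩} refl = refl

    module NFX = NormalForm elt elt-injective σX (λ _ _ → refl)

    incl-≈ : ∀ u v → GX._≈_ P u v → GI._≈_ (incl u) (incl v)
    incl-≈ u v = ≈-mapWord elt λ where
      (r-inv x)             → r-inv (elt x)
      (r-comm y₁ y₂ y₁≡y₂)  → r-comm (elt y₁) (elt y₂) y₁≡y₂
      (r-conj x y₁ y₂ ⊛xy)  → r-conj (elt x) (elt y₁) (elt y₂) ⊛xy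

    incl-word : ∀ xs → incl {P = P} (word xs) ≡ word (map elt xs)
    incl-word xs = trans (sym (List.map-∘ xs)) (List.map-∘ xs)

    normalFormX-unique′ : ∀ {xs ys} → AllPairs NFX._<B_ xs → AllPairs NFX._<B_ ys →
                          GI._≈_ (incl (word xs)) (incl (word ys)) → xs ≡ ys
    normalFormX-unique′ {xs} {ys} xs↑ ys↑ xs≈ys = List.map-injective elt-injective
      (normalForm-unique (AllPairs.map⁺ xs↑) (AllPairs.map⁺ ys↑)
                         (subst₂ GI._≈_ (incl-word xs) (incl-word ys) xs≈ys))

    normalFormX-exists : ∀ w → Σ (List (SubX P)) λ xs → Linked NFX._<B_ xs × GX._≈_ P w (word xs)
    normalFormX-exists w = NFX.normalise w , AllPairs⇒Linked (NFX.normalise-sorted w) , NFX.normalise-≈ w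

    normalFormX-unique : ∀ xs ys → Linked NFX._<B_ xs → Linked NFX._<B_ ys →
                         GX._≈_ P (word xs) (word ys) → xs ≡ ys
    normalFormX-unique xs ys xs↑ ys↑ xs≈ys =
      normalFormX-unique′ (Linked⇒AllPairs <*-trans xs↑) (Linked⇒AllPairs <*-trans ys↑) (incl-≈ _ _ xs≈ys)

    incl-reflects-≈ : ∀ u v → GI._≈_ (incl u) (incl v) → GX._≈_ P u v
    incl-reflects-≈ u v u≈v = GX.≈-trans (NFX.normalise-≈ u)
      (subst (λ t → GX._≈_ P (word t) v) (sym normalise≡) (GX.≈-sym (NFX.normalise-≈ v)))
      where
      normalise≡ : NFX.normalise u ≡ NFX.normalise v
      normalise≡ = normalFormX-unique′ (NFX.normalise-sorted u) (NFX.normalise-sorted v)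
        (GI.≈-trans (GI.≈-sym (incl-≈ _ _ (NFX.normalise-≈ u)))
                    (GI.≈-trans u≈v (incl-≈ _ _ (NFX.normalise-≈ v))))

claim1p6 : ∀ {a ℓ ℓ' p : Level} {A : Set a} (_<I_ : Rel A ℓ) →
    IsStrictPartialOrder _≡_ _<I_ →
    let open Setup _<I_ in
    (_<*_ : Rel XI ℓ') → IsStrictTotalOrder _≡_ _<*_ →
    (∀ x y → n y < n x → x <* y) →
    -- (1) existence and uniqueness of normal forms in G_I
    ((∀ (w : GI.Word) → Σ (List XI) (λ xs → Linked _<*_ xs × GI._≈_ w (word xs))) ×
     (∀ xs ys → Linked _<*_ xs → Linked _<*_ ys →
        GI._≈_ (word xs) (word ys) → xs ≡ ys)) ×
    -- (3) the same for G_X when X is closed under ⊛, and G_X ↪ G_I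
    (∀ (P : XI → Set p) →
       (∀ x y₁ y₂ → ⊛ x y₁ y₂ → P x → P y₁ → P y₂) →
       ((∀ (w : GX.Word P) → Σ (List (SubX P))
            (λ xs → Linked (λ u v → elt u <* elt v) xs × GX._≈_ P w (word xs))) ×
        (∀ xs ys → Linked (λ u v → elt u <* elt v) xs →
           Linked (λ u v → elt u <* elt v) ys →
           GX._≈_ P (word xs) (word ys) → xs ≡ ys) ×
        (∀ u v → GX._≈_ P u v → GI._≈_ (incl u) (incl v)) ×
        (∀ u v → GI._≈_ (incl u) (incl v) → GX._≈_ P u v))) ×
    -- (4) normal forms are shortest
    (∀ (ys xs : List XI) → Linked _<*_ xs →
       GI._≈_ (word ys) (word xs) → length xs ≤ length ys)
claim1p6 _<I_ _ _<*_ <*-isStrictTotalOrder <*-level =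
  (normalForm-exists , λ _ _ xs↑ ys↑ → normalForm-unique (sorted xs↑) (sorted ys↑)) ,
  (λ P P-closed → let open Subgroup P P-closed in
     normalFormX-exists , normalFormX-unique , incl-≈ , incl-reflects-≈) ,
  normalForm-shortest
  where open Main _<I_ _<*_ <*-isStrictTotalOrder <*-level
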